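{- Let $r\ge1$. Let $B_r$ be the $r\times 2r$ matrix with columns indexed by $0,\dots,2r-1$ whose $k$th row ($1\le k\le r$) has entry $-1$ in column $r-k$, entry $1$ in column $r-1+k$, and zeros elsewhere. Let $C_r$ be the $r\times(2r+1)$ matrix with columns indexed by $0,\dots,2r$ whose $k$th row ($1\le k\le r$) has entry $-1$ in column $r-k$, entry $1$ in column $r+k$, and zeros elsewhere. For a partition $\lambda$ of length at most $r$ let $I(\lambda)=\{\lambda_r,\lambda_{r-1}+1,\dots,\lambda_1+r-1\}$, and for a matrix $M$ let $\Delta_{I(\lambda)}(M)$ be the $r\times r$ submatrix formed by the columns indexed by $I(\lambda)$ in increasing order. Then for every partition $\lambda$ of length at most $r$: (1) $\det\Delta_{I(\lambda)}(B_r)=(-1)^{\binom{r+1}{2}+(|\lambda|+p(\lambda))/2}$ if $\lambda\in\mathcal{R}_r$, and $=0$ otherwise; (2) $\det\Delta_{I(\lambda)}(C_r)=(-1)^{\binom{r+1}{2}+|\lambda|/2}$ if $\lambda\in\mathcal{Q}_r$, and $=0$ otherwise.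
   Context: Partitions in Frobenius notation: $(\alpha_1,\dots,\alpha_p\,|\,\beta_1,\dots,\beta_p)$ with $p=p(\lambda)$ the number of diagonal boxes (length of the main diagonal of the Young diagram), $\alpha_i=\lambda_i-i$, $\beta_i=\lambda'_i-i$. $\mathcal{Q}_r$ (resp. $\mathcal{R}_r$) is the set of partitions of length at most $r$ of the form $(\alpha_1+1,\dots,\alpha_p+1\,|\,\alpha_1,\dots,\alpha_p)$ (resp. $(\alpha_1,\dots,\alpha_p\,|\,\alpha_1,\dots,\alpha_p)$), $p\ge0$, the empty partition included. Convention: if $I(\lambda)$ is not contained in the column index set, the corresponding determinant is taken to be $0$. -}

module Defs where

open import Data.Nat using (ℕ; zero; suc; _+_; _∸_; _<_; _≤_; _≤?_; _<?_; _≡ᵇ_)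
open import Data.Nat.Combinatorics using (_C_)
open import Data.Integer as ℤ using (ℤ; 0ℤ; 1ℤ; -1ℤ)
open import Data.Fin as Fin using (Fin; zero; suc; toℕ; fromℕ<; punchIn; opposite)
open import Data.Fin.Properties using (all?)
open import Data.Vec using (Vec; lookup; toList)
open import Data.Nat.ListAction using (sum)
open import Data.Bool using (Bool; true; false; if_then_else_)
open import Relation.Nullary using (yes; no; ¬_)
open import Relation.Nullary.Decidable using (⌊_⌋)
open import Relation.Binary.PropositionalEquality using (_≡_)

signPow : ℕ → ℤ
signPow zero = 1ℤ
signPow (suc n) = ℤ.- signPow n

sumFin : ∀ {n} → (Fin n → ℤ) → ℤ
sumFin {zero} f = 0ℤ
sumFin {suc n} f = f zero ℤ.+ sumFin (λ i → f (suc i))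

count : ∀ {n} → (Fin n → Bool) → ℕ
count {zero} f = 0
count {suc n} f = (if f zero then 1 else 0) + count (λ i → f (suc i))

det : ∀ n → (Fin n → Fin n → ℤ) → ℤ
det zero M = 1ℤ
det (suc n) M =
  sumFin (λ j → signPow (toℕ j) ℤ.* (M zero j ℤ.* det n (λ a b → M (suc a) (punchIn j b))))

-- Partitions of length at most r: weakly decreasing vectors (λ₁,…,λᵣ),
-- the entry at index i : Fin r being λ_{i+1}.

IsPartition : ∀ {r} → Vec ℕ r → Set
IsPartition {r} lam = (i j : Fin r) → toℕ i ≤ toℕ j → lookup lam j ≤ lookup lam i

size : ∀ {r} → Vec ℕ r → ℕ
size lam = sum (toList lam)

-- p(λ) : number of diagonal boxes = #{ i ≥ 1 : λᵢ ≥ i }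
diag : ∀ {r} → Vec ℕ r → ℕ
diag lam = count (λ i → ⌊ suc (toℕ i) ≤? lookup lam i ⌋)

conj : ∀ {r} → Vec ℕ r → ℕ → ℕ
conj lam i = count (λ j → ⌊ i ≤? lookup lam j ⌋)

-- Frobenius coordinates αᵢ = λᵢ - i, βᵢ = λ'ᵢ - i, for index i+1 (i : Fin r)
frobα : ∀ {r} → Vec ℕ r → Fin r → ℕ
frobα lam i = lookup lam i ∸ suc (toℕ i)

frobβ : ∀ {r} → Vec ℕ r → Fin r → ℕ
frobβ lam i = conj lam (suc (toℕ i)) ∸ suc (toℕ i)

-- λ ∈ 𝓡_r : λ = (α₁,…,α_p | α₁,…,α_p)
InR : ∀ {r} → Vec ℕ r → Set
InR {r} lam = (i : Fin r) → toℕ i < diag lam → frobα lam i ≡ frobβ lam i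

-- λ ∈ 𝓠_r : λ = (α₁+1,…,α_p+1 | α₁,…,α_p)
InQ : ∀ {r} → Vec ℕ r → Set
InQ {r} lam = (i : Fin r) → toℕ i < diag lam → frobα lam i ≡ suc (frobβ lam i)

-- Column index set I(λ) = {λᵣ, λ_{r-1}+1, …, λ₁+r-1}, listed increasingly:
-- the j-th column (j : Fin r, 0-based) is λ_{r-j} + j.
Icols : ∀ {r} → Vec ℕ r → Fin r → ℕ
Icols lam j = lookup lam (opposite j) + toℕ j

-- det Δ_I(M) for M with m columns indexed 0,…,m-1; 0 if I ⊄ {0,…,m-1}.
detΔ : ∀ {r m} → (Fin r → Fin m → ℤ) → (Fin r → ℕ) → ℤ
detΔ {r} {m} M cols with all? (λ j → cols j <? m)
... | yes ok = det r (λ i j → M i (fromℕ< (ok j)))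
... | no _ = 0ℤ

Bmat : ∀ r → Fin r → Fin (r + r) → ℤ
Bmat r i c =
  if toℕ c ≡ᵇ (r ∸ suc (toℕ i)) then -1ℤ
  else if toℕ c ≡ᵇ (r + toℕ i) then 1ℤ
  else 0ℤ

Cmat : ∀ r → Fin r → Fin (suc (r + r)) → ℤ
Cmat r i c =
  if toℕ c ≡ᵇ (r ∸ suc (toℕ i)) then -1ℤ
  else if toℕ c ≡ᵇ (r + suc (toℕ i)) then 1ℤ
  else 0ℤ

module Submission where

-- Every column of B_r and C_r has at most one nonzero entry, so a maximal minor is the
-- determinant of a monomial matrix: up to the sign of the row permutation, the product of its
-- entries if the chosen columns meet every row exactly once, and 0 otherwise. Treat both matrices
-- at once, as the matrix with a gap of g = 0 or g = 1 zero columns, and induct on r. If the last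
-- part of λ is zero, column 0 is chosen and fills the top row with weight -1. Otherwise removing the
-- first row and column of λ leaves a partition μ, and the last column λ₁ + r - 1 fills the top row
-- (with weight +1) exactly when λ₁ = r + g, that is α₁ = β₁ + g; in all other cases the minor has a
-- zero column, an empty row or two columns in the same row.

open import Defs
open import Data.Bool using (Bool; true; false; if_then_else_)
open import Data.Bool.Properties using (if-cong; if-cong-then; if-eta)
open import Data.Fin as Fin using (Fin; zero; suc; toℕ; fromℕ; fromℕ<; inject₁; punchIn; punchOut; opposite)
import Data.Fin.Properties as Finₚ
open import Data.Fin.Properties using (all?)
open import Data.Integer as ℤ using (ℤ; 0ℤ; 1ℤ; -1ℤ)
import Data.Integer.Properties as ℤₚ
open import Data.Nat as ℕ using (ℕ; zero; suc; _+_; _*_; _∸_; _≤_; _<_; _≤?_; _<?_; _≡ᵇ_; _<ᵇ_; z≤n; s≤s; _/_)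
import Data.Nat.Properties as ℕₚ
open import Data.Nat.Combinatorics using (_C_)
import Data.Nat.Combinatorics as Combinatorics
open import Data.Nat.DivMod using (m*n/n≡m)
open import Data.Nat.ListAction using (sum)
open import Data.Nat.ListAction.Properties using (sum-++)
open import Data.Nat.Tactic.RingSolver using (solve-∀)
open import Data.Product using (∃; _×_; _,_; proj₁; proj₂)
open import Data.Sum as Sum using (_⊎_; inj₁; inj₂)
import Data.List as List
open import Data.Vec using (Vec; []; _∷_; _∷ʳ_; lookup; map; toList; initLast)
import Data.Vec.Properties as Vecₚ
open import Function using (_∘_; _⇔_; mk⇔; Equivalence)
open import Relation.Nullary using (¬_; yes; no; contradiction)
open import Relation.Nullary.Decidable using (⌊_⌋; dec-true; dec-false; does-⇔; isYes≗does)
open import Relation.Binary.PropositionalEquality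
import Algebra.Properties.CommutativeSemigroup as CommSemigroupProperties

open CommSemigroupProperties ℕₚ.+-commutativeSemigroup using () renaming (x∙yz≈y∙xz to +-exchange)
open CommSemigroupProperties ℤₚ.*-commutativeSemigroup using () renaming (x∙yz≈y∙xz to *-exchange)

sumFin-cong : ∀ {n} {f g : Fin n → ℤ} → (∀ j → f j ≡ g j) → sumFin f ≡ sumFin g
sumFin-cong {zero} e = refl
sumFin-cong {suc n} e = cong₂ ℤ._+_ (e zero) (sumFin-cong (e ∘ suc))

sumFin-zero : ∀ {n} (f : Fin n → ℤ) → (∀ j → f j ≡ 0ℤ) → sumFin f ≡ 0ℤ
sumFin-zero {zero} f e = refl
sumFin-zero {suc n} f e rewrite e zero | sumFin-zero (f ∘ suc) (e ∘ suc) = refl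

sumFin-single : ∀ {n} (f : Fin n → ℤ) (k : Fin n) → (∀ j → j ≢ k → f j ≡ 0ℤ) → sumFin f ≡ f k
sumFin-single {suc n} f zero e
  rewrite sumFin-zero (f ∘ suc) (λ j → e (suc j) λ ()) = ℤₚ.+-identityʳ (f zero)
sumFin-single {suc n} f (suc k) e
  rewrite e zero (λ ()) | sumFin-single (f ∘ suc) k (λ j j≢k → e (suc j) (j≢k ∘ Finₚ.suc-injective))
  = ℤₚ.+-identityˡ (f (suc k))

boolToℕ : Bool → ℕ
boolToℕ b = if b then 1 else 0

count-cong : ∀ {n} {f g : Fin n → Bool} → (∀ j → f j ≡ g j) → count f ≡ count g
count-cong {zero} e = refl
count-cong {suc n} e = cong₂ _+_ (cong boolToℕ (e zero)) (count-cong (e ∘ suc))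

count-false : ∀ {n} (f : Fin n → Bool) → (∀ j → f j ≡ false) → count f ≡ 0
count-false {zero} f e = refl
count-false {suc n} f e rewrite e zero = count-false (f ∘ suc) (e ∘ suc)

count-true : ∀ {n} (f : Fin n → Bool) → (∀ j → f j ≡ true) → count f ≡ n
count-true {zero} f e = refl
count-true {suc n} f e rewrite e zero = cong suc (count-true (f ∘ suc) (e ∘ suc))

count-≤ : ∀ {n} (f : Fin n → Bool) → count f ≤ n
count-≤ {zero} f = z≤n
count-≤ {suc n} f with f zero
... | true = s≤s (count-≤ (f ∘ suc))
... | false = ℕₚ.m≤n⇒m≤1+n (count-≤ (f ∘ suc))

count-punchIn : ∀ {n} (f : Fin (suc n) → Bool) (k : Fin (suc n)) →
  count f ≡ boolToℕ (f k) + count (f ∘ punchIn k)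
count-punchIn f zero = refl
count-punchIn {suc n} f (suc k) rewrite count-punchIn (f ∘ suc) k =
  +-exchange (boolToℕ (f zero)) (boolToℕ (f (suc k))) _

prodFin : ∀ {n} → (Fin n → ℤ) → ℤ
prodFin {zero} w = 1ℤ
prodFin {suc n} w = w zero ℤ.* prodFin (w ∘ suc)

prodFin-cong : ∀ {n} {v w : Fin n → ℤ} → (∀ j → v j ≡ w j) → prodFin v ≡ prodFin w
prodFin-cong {zero} e = refl
prodFin-cong {suc n} e = cong₂ ℤ._*_ (e zero) (prodFin-cong (e ∘ suc))

prodFin-punchIn : ∀ {n} (w : Fin (suc n) → ℤ) (k : Fin (suc n)) → prodFin w ≡ w k ℤ.* prodFin (w ∘ punchIn k)
prodFin-punchIn w zero = refl
prodFin-punchIn {suc n} w (suc k) rewrite prodFin-punchIn (w ∘ suc) k = *-exchange (w zero) (w (suc k)) _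

signPow-+ : ∀ a b → signPow (a + b) ≡ signPow a ℤ.* signPow b
signPow-+ zero b = sym (ℤₚ.*-identityˡ (signPow b))
signPow-+ (suc a) b rewrite signPow-+ a b = ℤₚ.neg-distribˡ-* (signPow a) (signPow b)

signPow-double : ∀ k a → signPow (k + k + a) ≡ signPow a
signPow-double zero a = refl
signPow-double (suc k) a rewrite ℕₚ.+-suc k k = trans (ℤₚ.neg-involutive _) (signPow-double k a)

<ᵇ-true : ∀ {m n} → m < n → (m <ᵇ n) ≡ true
<ᵇ-true {m} {n} = dec-true (m <? n)

<ᵇ-false : ∀ {m n} → n ≤ m → (m <ᵇ n) ≡ false
<ᵇ-false {m} {n} n≤m = dec-false (m <? n) (ℕₚ.≤⇒≯ n≤m)

≤?-true : ∀ {a b} → a ≤ b → ⌊ a ≤? b ⌋ ≡ true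
≤?-true {a} {b} a≤b = trans (isYes≗does (a ≤? b)) (dec-true (a ≤? b) a≤b)

≤?-suc : ∀ a b → ⌊ suc a ≤? suc b ⌋ ≡ ⌊ a ≤? b ⌋
≤?-suc a b = begin
  ⌊ suc a ≤? suc b ⌋    ≡⟨ isYes≗does (suc a ≤? suc b) ⟩
  ℕ.suc a ℕ.≤ᵇ suc b     ≡⟨ does-⇔ (mk⇔ ℕₚ.≤-pred s≤s) (suc a ≤? suc b) (a ≤? b) ⟩
  a ℕ.≤ᵇ b               ≡⟨ isYes≗does (a ≤? b) ⟨
  ⌊ a ≤? b ⌋            ∎
  where open ≡-Reasoning

data PunchInView {n} (k : Fin (suc n)) : Fin (suc n) → Set where
  here  : PunchInView k k
  there : ∀ j → PunchInView k (punchIn k j)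

punchInView : ∀ {n} (k j : Fin (suc n)) → PunchInView k j
punchInView k j with k Fin.≟ j
... | yes refl = here
... | no k≢j = subst (PunchInView k) (Finₚ.punchIn-punchOut k≢j) (there (punchOut k≢j))

punchIn-fromℕ : ∀ {n} (j : Fin n) → punchIn (fromℕ n) j ≡ inject₁ j
punchIn-fromℕ zero = refl
punchIn-fromℕ (suc j) = cong suc (punchIn-fromℕ j)

opposite-fromℕ : ∀ n → opposite (fromℕ n) ≡ zero
opposite-fromℕ zero = refl
opposite-fromℕ (suc n) = cong inject₁ (opposite-fromℕ n)

opposite-inject₁ : ∀ {n} (j : Fin n) → opposite (inject₁ j) ≡ suc (opposite j)
opposite-inject₁ {suc n} zero = refl
opposite-inject₁ {suc n} (suc j) = cong inject₁ (opposite-inject₁ j)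

minor : ∀ {n} → (Fin (suc n) → Fin (suc n) → ℤ) → Fin (suc n) → Fin n → Fin n → ℤ
minor M j a b = M (suc a) (punchIn j b)

laplaceTerm : ∀ {n} → (Fin (suc n) → Fin (suc n) → ℤ) → Fin (suc n) → ℤ
laplaceTerm {n} M j = signPow (toℕ j) ℤ.* (M zero j ℤ.* det n (minor M j))

laplaceTerm-zero : ∀ {n} (M : Fin (suc n) → Fin (suc n) → ℤ) j →
  M zero j ≡ 0ℤ ⊎ det n (minor M j) ≡ 0ℤ → laplaceTerm M j ≡ 0ℤ
laplaceTerm-zero M j (inj₁ e) rewrite e = ℤₚ.*-zeroʳ (signPow (toℕ j))
laplaceTerm-zero M j (inj₂ e) rewrite e | ℤₚ.*-zeroʳ (M zero j) = ℤₚ.*-zeroʳ (signPow (toℕ j))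

det-cong : ∀ n {M N : Fin n → Fin n → ℤ} → (∀ i j → M i j ≡ N i j) → det n M ≡ det n N
det-cong zero e = refl
det-cong (suc n) e = sumFin-cong λ j →
  cong₂ (λ a d → signPow (toℕ j) ℤ.* (a ℤ.* d)) (e zero j) (det-cong n λ a b → e (suc a) (punchIn j b))

det-zeroRow : ∀ n (M : Fin n → Fin n → ℤ) (i : Fin n) → (∀ j → M i j ≡ 0ℤ) → det n M ≡ 0ℤ
det-zeroRow (suc n) M zero e = sumFin-zero _ λ j → laplaceTerm-zero M j (inj₁ (e j))
det-zeroRow (suc n) M (suc i) e = sumFin-zero _ λ j →
  laplaceTerm-zero M j (inj₂ (det-zeroRow n (minor M j) i (e ∘ punchIn j)))

det-zeroColumn : ∀ n (M : Fin n → Fin n → ℤ) (k : Fin n) → (∀ i → M i k ≡ 0ℤ) → det n M ≡ 0ℤ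
det-zeroColumn (suc n) M k e = sumFin-zero _ term
  where
  term : ∀ j → laplaceTerm M j ≡ 0ℤ
  term j with j Fin.≟ k
  ... | yes refl = laplaceTerm-zero M j (inj₁ (e zero))
  ... | no j≢k = laplaceTerm-zero M j (inj₂ (det-zeroColumn n (minor M j) (punchOut j≢k)
          λ a → subst (λ c → M (suc a) c ≡ 0ℤ) (sym (Finₚ.punchIn-punchOut j≢k)) (e (suc a))))

-- Monomial matrices

-- A row index σ j ≥ n makes column j zero.
monomial : ∀ {n} → (Fin n → ℕ) → (Fin n → ℤ) → Fin n → Fin n → ℤ
monomial σ w i j = if toℕ i ≡ᵇ σ j then w j else 0ℤ

-- Row indices after deleting row 0; an entry of row 0 is sent out of range, to row n.
lowerRow : ℕ → ℕ → ℕ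
lowerRow n zero = n
lowerRow n (suc v) = v

minor-monomial : ∀ {n} (σ : Fin (suc n) → ℕ) w k (a b : Fin n) →
  minor (monomial σ w) k a b ≡ monomial (lowerRow n ∘ σ ∘ punchIn k) (w ∘ punchIn k) a b
minor-monomial {n} σ w k a b = if-cong (lowered (σ (punchIn k b)))
  where
  lowered : ∀ v → (suc (toℕ a) ≡ᵇ v) ≡ (toℕ a ≡ᵇ lowerRow n v)
  lowered zero = sym (dec-false (toℕ a ℕ.≟ n) (ℕₚ.<⇒≢ (Finₚ.toℕ<n a)))
  lowered (suc v) = refl

det-minor-monomial : ∀ n (σ : Fin (suc n) → ℕ) w k →
  det n (minor (monomial σ w) k) ≡ det n (monomial (lowerRow n ∘ σ ∘ punchIn k) (w ∘ punchIn k))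
det-minor-monomial n σ w k = det-cong n (minor-monomial σ w k)

det-monomial-zeroWeight : ∀ n (σ : Fin n → ℕ) w j → w j ≡ 0ℤ → det n (monomial σ w) ≡ 0ℤ
det-monomial-zeroWeight n σ w j e =
  det-zeroColumn n _ j λ i → trans (if-cong-then (toℕ i ≡ᵇ σ j) e) (if-eta (toℕ i ≡ᵇ σ j))

det-monomial-rowOutOfRange : ∀ n (σ : Fin n → ℕ) w j → n ≤ σ j → det n (monomial σ w) ≡ 0ℤ
det-monomial-rowOutOfRange n σ w j n≤σj = det-zeroColumn n _ j λ i →
  if-cong (dec-false (toℕ i ℕ.≟ σ j) λ e → ℕₚ.<⇒≱ (Finₚ.toℕ<n i) (subst (n ≤_) (sym e) n≤σj))

det-monomial-missingRow : ∀ n (σ : Fin n → ℕ) w i → (∀ j → σ j ≢ toℕ i) → det n (monomial σ w) ≡ 0ℤ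
det-monomial-missingRow n σ w i missing = det-zeroRow n _ i λ j →
  if-cong (dec-false (toℕ i ℕ.≟ σ j) (missing j ∘ sym))

-- Along row 0 only columns k in row 0 contribute; their minor either keeps one of the two
-- repeated columns, now out of range, or again has a repeated row.
det-monomial-repeatedRow : ∀ n (σ : Fin n → ℕ) w {j₁ j₂} → j₁ ≢ j₂ → σ j₁ ≡ σ j₂ →
  det n (monomial σ w) ≡ 0ℤ
det-monomial-repeatedRow (suc n) σ w {j₁} {j₂} j₁≢j₂ repeated = sumFin-zero _ term
  where
  term : ∀ k → laplaceTerm (monomial σ w) k ≡ 0ℤ
  term k = atRow (σ k) refl
    where
    σ′ = lowerRow n ∘ σ ∘ punchIn k

    σ′-punchOut : ∀ {j} (k≢j : k ≢ j) → σ′ (punchOut k≢j) ≡ lowerRow n (σ j)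
    σ′-punchOut k≢j = cong (lowerRow n ∘ σ) (Finₚ.punchIn-punchOut k≢j)

    survivesOutOfRange : ∀ {j} (k≢j : k ≢ j) → σ j ≡ 0 → det n (monomial σ′ (w ∘ punchIn k)) ≡ 0ℤ
    survivesOutOfRange k≢j σj = det-monomial-rowOutOfRange n σ′ _ (punchOut k≢j)
      (ℕₚ.≤-reflexive (sym (trans (σ′-punchOut k≢j) (cong (lowerRow n) σj))))

    minorVanishes : σ k ≡ 0 → ∀ v → σ j₁ ≡ v → det n (monomial σ′ (w ∘ punchIn k)) ≡ 0ℤ
    minorVanishes σk zero σj₁ with k Fin.≟ j₁
    ... | yes k≡j₁ = survivesOutOfRange (j₁≢j₂ ∘ trans (sym k≡j₁)) (trans (sym repeated) σj₁)
    ... | no k≢j₁ = survivesOutOfRange k≢j₁ σj₁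
    minorVanishes σk (suc _) σj₁ = det-monomial-repeatedRow n σ′ _ {punchOut k≢j₁} {punchOut k≢j₂}
      (j₁≢j₂ ∘ Finₚ.punchOut-injective k≢j₁ k≢j₂)
      (trans (σ′-punchOut k≢j₁) (trans (cong (lowerRow n) repeated) (sym (σ′-punchOut k≢j₂))))
      where
      k≢j₁ : k ≢ j₁
      k≢j₁ refl = ℕₚ.0≢1+n (trans (sym σk) σj₁)
      k≢j₂ : k ≢ j₂
      k≢j₂ refl = ℕₚ.0≢1+n (trans (sym σk) (trans (sym repeated) σj₁))

    atRow : ∀ v → σ k ≡ v → laplaceTerm (monomial σ w) k ≡ 0ℤ
    atRow (suc _) σk = laplaceTerm-zero (monomial σ w) k (inj₁ (if-cong (cong (0 ≡ᵇ_) σk)))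
    atRow zero σk = laplaceTerm-zero (monomial σ w) k
      (inj₂ (trans (det-minor-monomial n σ w k) (minorVanishes σk (σ j₁) refl)))

data Degenerate {n} (σ : Fin n → ℕ) (w : Fin n → ℤ) : Set where
  missingRow  : (i : Fin n) → (∀ j → σ j ≢ toℕ i) → Degenerate σ w
  repeatedRow : ∀ {j₁ j₂} → j₁ ≢ j₂ → σ j₁ ≡ σ j₂ → Degenerate σ w
  zeroWeight  : ∀ {j} → w j ≡ 0ℤ → Degenerate σ w

det-monomial-degenerate : ∀ n {σ : Fin n → ℕ} {w} → Degenerate σ w → det n (monomial σ w) ≡ 0ℤ
det-monomial-degenerate n (missingRow i missing) = det-monomial-missingRow n _ _ i missing
det-monomial-degenerate n (repeatedRow j₁≢j₂ repeated) = det-monomial-repeatedRow n _ _ j₁≢j₂ repeated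
det-monomial-degenerate n (zeroWeight {j} e) = det-monomial-zeroWeight n _ _ j e

inversions : ∀ {n} → (Fin n → ℕ) → ℕ
inversions {zero} σ = 0
inversions {suc n} σ = count (λ j → σ (suc j) <ᵇ σ zero) + inversions (σ ∘ suc)

inversions-cong : ∀ {n} {σ τ : Fin n → ℕ} → (∀ j → σ j ≡ τ j) → inversions σ ≡ inversions τ
inversions-cong {zero} e = refl
inversions-cong {suc n} e =
  cong₂ _+_ (count-cong λ j → cong₂ _<ᵇ_ (e (suc j)) (e zero)) (inversions-cong (e ∘ suc))

inversions-lowerRow : ∀ {n} m (σ : Fin n → ℕ) → (∀ j → σ j ≢ 0) →
  inversions (lowerRow m ∘ σ) ≡ inversions σ
inversions-lowerRow {zero} m σ nonzero = refl
inversions-lowerRow {suc n} m σ nonzero =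
  cong₂ _+_ (count-cong λ j → lowered (σ (suc j)) (σ zero) (nonzero (suc j)) (nonzero zero))
            (inversions-lowerRow m (σ ∘ suc) (nonzero ∘ suc))
  where
  lowered : ∀ u v → u ≢ 0 → v ≢ 0 → (lowerRow m u <ᵇ lowerRow m v) ≡ (u <ᵇ v)
  lowered zero _ u≢0 _ = contradiction refl u≢0
  lowered (suc _) zero _ v≢0 = contradiction refl v≢0
  lowered (suc _) (suc _) _ _ = refl

inversions-removeMin : ∀ {n} (σ : Fin (suc n) → ℕ) k → σ k ≡ 0 → (∀ j → σ (punchIn k j) ≢ 0) →
  inversions σ ≡ toℕ k + inversions (σ ∘ punchIn k)
inversions-removeMin σ zero σk≡0 _ =
  cong (_+ inversions (σ ∘ suc))
       (count-false (λ j → σ (suc j) <ᵇ σ zero) λ j → <ᵇ-false (subst (_≤ σ (suc j)) (sym σk≡0) z≤n))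
inversions-removeMin {suc n} σ (suc k) σk≡0 nonzero = begin
  count (λ j → σ (suc j) <ᵇ σ zero) + inversions (σ ∘ suc)
    ≡⟨ cong₂ _+_ (count-punchIn (λ j → σ (suc j) <ᵇ σ zero) k)
                 (inversions-removeMin (σ ∘ suc) k σk≡0 (nonzero ∘ suc)) ⟩
  (boolToℕ (σ (suc k) <ᵇ σ zero) + c) + (toℕ k + i)
    ≡⟨ cong (λ b → (boolToℕ b + c) + (toℕ k + i)) (<ᵇ-true (subst (_< σ zero) (sym σk≡0) σ₀>0)) ⟩
  suc (c + (toℕ k + i))
    ≡⟨ cong suc (+-exchange c (toℕ k) i) ⟩
  suc (toℕ k + (c + i)) ∎
  where
  open ≡-Reasoning
  c = count (λ j → σ (suc (punchIn k j)) <ᵇ σ zero)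
  i = inversions (σ ∘ suc ∘ punchIn k)
  σ₀>0 : 0 < σ zero
  σ₀>0 = ℕₚ.n≢0⇒n>0 (nonzero zero)

-- The new maximum at position k is inverted with exactly the n ∸ toℕ k entries after it.
inversions-insertMax : ∀ {n T} (τ : Fin (suc n) → ℕ) (σ : Fin n → ℕ) k → τ k ≡ T →
  (∀ j → τ (punchIn k j) ≡ σ j) → (∀ j → σ j < T) → inversions τ ≡ (n ∸ toℕ k) + inversions σ
inversions-insertMax τ σ zero τk≡T rest below =
  cong₂ _+_ (count-true _ λ j → <ᵇ-true (subst₂ _<_ (sym (rest j)) (sym τk≡T) (below j)))
            (inversions-cong rest)
inversions-insertMax {suc n} τ σ (suc k) τk≡T rest below = begin
  count (λ j → τ (suc j) <ᵇ τ zero) + inversions (τ ∘ suc)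
    ≡⟨ cong₂ _+_ (count-punchIn (λ j → τ (suc j) <ᵇ τ zero) k)
                 (inversions-insertMax (τ ∘ suc) (σ ∘ suc) k τk≡T (rest ∘ suc) (below ∘ suc)) ⟩
  (boolToℕ (τ (suc k) <ᵇ τ zero) + c) + ((n ∸ toℕ k) + i)
    ≡⟨ cong (λ b → (boolToℕ b + c) + ((n ∸ toℕ k) + i))
            (<ᵇ-false (ℕₚ.<⇒≤ (subst₂ _<_ (sym (rest zero)) (sym τk≡T) (below zero)))) ⟩
  c + ((n ∸ toℕ k) + i)
    ≡⟨ +-exchange c (n ∸ toℕ k) i ⟩
  (n ∸ toℕ k) + (c + i)
    ≡⟨ cong (λ c → (n ∸ toℕ k) + (c + i))
            (count-cong λ j → cong₂ _<ᵇ_ (rest (suc j)) (rest zero)) ⟩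
  (n ∸ toℕ k) + inversions σ ∎
  where
  open ≡-Reasoning
  c = count (λ j → τ (suc (punchIn k j)) <ᵇ τ zero)
  i = inversions (σ ∘ suc)

record IsRowBijection (n : ℕ) (σ : Fin n → ℕ) : Set where
  field
    bounded    : ∀ j → σ j < n
    surjective : ∀ i → i < n → ∃ λ j → σ j ≡ i
    injective  : ∀ {j₁ j₂} → σ j₁ ≡ σ j₂ → j₁ ≡ j₂

IsRowBijection-lowerRow : ∀ {n} {σ : Fin (suc n) → ℕ} {k} → IsRowBijection (suc n) σ → σ k ≡ 0 →
  IsRowBijection n (lowerRow n ∘ σ ∘ punchIn k)
IsRowBijection-lowerRow {n} {σ} {k} bij σk≡0 = record
  { bounded    = λ j → lowered-< (σ (punchIn k j)) (nonzero j) (bounded (punchIn k j))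
  ; surjective = surjective′
  ; injective  = λ {j₁} {j₂} e →
      Finₚ.punchIn-injective k j₁ j₂ (injective (lowerRow-injective _ _ (nonzero j₁) (nonzero j₂) e))
  }
  where
  open IsRowBijection bij
  nonzero : ∀ j → σ (punchIn k j) ≢ 0
  nonzero j e = Finₚ.punchInᵢ≢i k j (injective (trans e (sym σk≡0)))
  lowered-< : ∀ v → v ≢ 0 → v < suc n → lowerRow n v < n
  lowered-< zero v≢0 _ = contradiction refl v≢0
  lowered-< (suc v) _ v<n = ℕₚ.≤-pred v<n
  lowerRow-injective : ∀ u v → u ≢ 0 → v ≢ 0 → lowerRow n u ≡ lowerRow n v → u ≡ v
  lowerRow-injective zero _ u≢0 _ _ = contradiction refl u≢0
  lowerRow-injective (suc _) zero _ v≢0 _ = contradiction refl v≢0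
  lowerRow-injective (suc _) (suc _) _ _ e = cong suc e
  surjective′ : ∀ i → i < n → ∃ λ j → lowerRow n (σ (punchIn k j)) ≡ i
  surjective′ i i<n with surjective (suc i) (s≤s i<n)
  ... | j , σj≡1+i with punchInView k j
  ...   | here = contradiction (trans (sym σk≡0) σj≡1+i) ℕₚ.0≢1+n
  ...   | there j′ = j′ , cong (lowerRow n) σj≡1+i

signedProduct : ∀ {n} → (Fin n → ℕ) → (Fin n → ℤ) → ℤ
signedProduct σ w = signPow (inversions σ) ℤ.* prodFin w

signedProduct-punchIn : ∀ {n} (τ : Fin (suc n) → ℕ) (v : Fin (suc n) → ℤ) {σ : Fin n → ℕ} {w} k a →
  inversions τ ≡ a + inversions σ → (∀ j → v (punchIn k j) ≡ w j) →
  signedProduct τ v ≡ signPow a ℤ.* (v k ℤ.* signedProduct σ w)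
signedProduct-punchIn τ v {σ} {w} k a inversions-τ rest = begin
  signPow (inversions τ) ℤ.* prodFin v
    ≡⟨ cong₂ (λ i p → signPow i ℤ.* p) inversions-τ
             (trans (prodFin-punchIn v k) (cong (v k ℤ.*_) (prodFin-cong rest))) ⟩
  signPow (a + inversions σ) ℤ.* (v k ℤ.* prodFin w)
    ≡⟨ cong (ℤ._* (v k ℤ.* prodFin w)) (signPow-+ a (inversions σ)) ⟩
  (signPow a ℤ.* signPow (inversions σ)) ℤ.* (v k ℤ.* prodFin w)
    ≡⟨ ℤₚ.*-assoc (signPow a) (signPow (inversions σ)) _ ⟩
  signPow a ℤ.* (signPow (inversions σ) ℤ.* (v k ℤ.* prodFin w))
    ≡⟨ cong (signPow a ℤ.*_) (*-exchange (signPow (inversions σ)) (v k) (prodFin w)) ⟩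
  signPow a ℤ.* (v k ℤ.* signedProduct σ w) ∎
  where open ≡-Reasoning

det-monomial-bijective : ∀ n (σ : Fin n → ℕ) w → IsRowBijection n σ →
  det n (monomial σ w) ≡ signedProduct σ w
det-monomial-bijective zero σ w _ = refl
det-monomial-bijective (suc n) σ w bij = begin
  det (suc n) (monomial σ w)
    ≡⟨ sumFin-single _ k offRow0 ⟩
  laplaceTerm (monomial σ w) k
    ≡⟨ cong₂ (λ a d → signPow (toℕ k) ℤ.* (a ℤ.* d)) (if-cong (cong (0 ≡ᵇ_) σk≡0)) minor≡ ⟩
  signPow (toℕ k) ℤ.* (w k ℤ.* signedProduct σ′ (w ∘ punchIn k))
    ≡⟨ signedProduct-punchIn σ w k (toℕ k) inversions-σ (λ _ → refl) ⟨
  signedProduct σ w ∎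
  where
  open ≡-Reasoning
  open IsRowBijection bij
  k = proj₁ (surjective 0 (s≤s z≤n))
  σk≡0 = proj₂ (surjective 0 (s≤s z≤n))
  σ′ = lowerRow n ∘ σ ∘ punchIn k
  nonzero : ∀ j → σ (punchIn k j) ≢ 0
  nonzero j e = Finₚ.punchInᵢ≢i k j (injective (trans e (sym σk≡0)))
  offRow0 : ∀ j → j ≢ k → laplaceTerm (monomial σ w) j ≡ 0ℤ
  offRow0 j j≢k = laplaceTerm-zero (monomial σ w) j
    (inj₁ (if-cong (dec-false (0 ℕ.≟ σ j) λ e → j≢k (injective (trans (sym e) (sym σk≡0))))))
  minor≡ : det n (minor (monomial σ w) k) ≡ signedProduct σ′ (w ∘ punchIn k)
  minor≡ = trans (det-minor-monomial n σ w k)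
                 (det-monomial-bijective n σ′ _ (IsRowBijection-lowerRow bij σk≡0))
  inversions-σ : inversions σ ≡ toℕ k + inversions σ′
  inversions-σ = trans (inversions-removeMin σ k σk≡0 nonzero)
                       (cong (toℕ k +_) (sym (inversions-lowerRow n (σ ∘ punchIn k) nonzero)))

IsRowBijection-insertTop : ∀ {n} (τ : Fin (suc n) → ℕ) (σ : Fin n → ℕ) k → τ k ≡ n →
  (∀ j → τ (punchIn k j) ≡ σ j) → IsRowBijection n σ → IsRowBijection (suc n) τ
IsRowBijection-insertTop {n} τ σ k τk≡n rest bij = record
  { bounded = bounded′ ; surjective = surjective′ ; injective = injective′ }
  where
  open IsRowBijection bij
  bounded′ : ∀ j → τ j < suc n
  bounded′ j with punchInView k j
  ... | here = ℕₚ.≤-reflexive (cong suc τk≡n)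
  ... | there j′ = ℕₚ.m≤n⇒m≤1+n (subst (_< n) (sym (rest j′)) (bounded j′))
  surjective′ : ∀ i → i < suc n → ∃ λ j → τ j ≡ i
  surjective′ i i<1+n with i ℕ.≟ n
  ... | yes refl = k , τk≡n
  ... | no i≢n with surjective i (ℕₚ.≤∧≢⇒< (ℕₚ.≤-pred i<1+n) i≢n)
  ...   | j , σj≡i = punchIn k j , trans (rest j) σj≡i
  notTop : ∀ j → τ k ≢ τ (punchIn k j)
  notTop j e = ℕₚ.<-irrefl (trans (sym (rest j)) (trans (sym e) τk≡n)) (bounded j)
  injective′ : ∀ {j₁ j₂} → τ j₁ ≡ τ j₂ → j₁ ≡ j₂
  injective′ {j₁} {j₂} e with punchInView k j₁ | punchInView k j₂
  ... | here | here = refl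
  ... | here | there b = contradiction e (notTop b)
  ... | there a | here = contradiction (sym e) (notTop a)
  ... | there a | there b = cong (punchIn k) (injective (trans (sym (rest a)) (trans e (rest b))))

Degenerate-insertTop : ∀ {n} (τ : Fin (suc n) → ℕ) (v : Fin (suc n) → ℤ) {σ : Fin n → ℕ} {w} k → τ k ≡ n →
  (∀ j → τ (punchIn k j) ≡ σ j) → (∀ j → v (punchIn k j) ≡ w j) → Degenerate σ w → Degenerate τ v
Degenerate-insertTop {n} τ v k τk≡n rest restWeight (missingRow i missing) = missingRow (inject₁ i) missing′
  where
  missing′ : ∀ j → τ j ≢ toℕ (inject₁ i)
  missing′ j e with punchInView k j
  ... | here = Finₚ.toℕ-inject₁-≢ i (trans (sym τk≡n) e)
  ... | there j′ = missing j′ (trans (sym (rest j′)) (trans e (Finₚ.toℕ-inject₁ i)))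
Degenerate-insertTop τ v k τk≡n rest restWeight (repeatedRow {j₁} {j₂} j₁≢j₂ repeated) =
  repeatedRow (j₁≢j₂ ∘ Finₚ.punchIn-injective k j₁ j₂) (trans (rest j₁) (trans repeated (sym (rest j₂))))
Degenerate-insertTop τ v k τk≡n rest restWeight (zeroWeight {j} e) = zeroWeight (trans (restWeight j) e)

-- The matrices with a gap of g zero columns

-- g = 0 gives B_r and g = 1 gives C_r, with rows and columns indexed from 0.
gapEntry : ℕ → ℕ → ℕ → ℕ → ℤ
gapEntry g r i c = if c ≡ᵇ r ∸ suc i then -1ℤ else if c ≡ᵇ r + (g + i) then 1ℤ else 0ℤ

-- The gap columns are encoded as weight 0 in row 0.
gapRow : ℕ → ℕ → ℕ → ℕ
gapRow g r c = if c <ᵇ r then r ∸ suc c else if c <ᵇ r + g then 0 else c ∸ (r + g)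

gapWeight : ℕ → ℕ → ℕ → ℤ
gapWeight g r c = if c <ᵇ r then -1ℤ else if c <ᵇ r + g then 0ℤ else 1ℤ

∸-suc-flip : ∀ {r i c} → i < r → c ≡ r ∸ suc i → i ≡ r ∸ suc c
∸-suc-flip {r} {i} {c} i<r c≡r-1-i = sym (begin
  r ∸ suc c           ≡⟨ cong (_∸ suc c) r≡1+c+i ⟩
  (suc c + i) ∸ suc c ≡⟨ ℕₚ.m+n∸m≡n (suc c) i ⟩
  i                   ∎)
  where
  open ≡-Reasoning
  r≡1+c+i : r ≡ suc c + i
  r≡1+c+i = trans (sym (ℕₚ.m∸n+n≡m i<r)) (trans (cong (_+ suc i) (sym c≡r-1-i)) (ℕₚ.+-suc c i))

∸-suc-< : ∀ {r i} → i < r → r ∸ suc i < r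
∸-suc-< i<r = ℕₚ.∸-monoʳ-< {o = 0} (s≤s z≤n) i<r

gapEntry-monomial : ∀ g r i c → i < r →
  gapEntry g r i c ≡ (if i ≡ᵇ gapRow g r c then gapWeight g r c else 0ℤ)
gapEntry-monomial g r i c i<r with c <? r | c <? r + g
... | yes c<r | _
  rewrite <ᵇ-true c<r | dec-false (c ℕ.≟ r + (g + i)) (ℕₚ.<⇒≢ (ℕₚ.<-≤-trans c<r (ℕₚ.m≤m+n r (g + i))))
  = if-cong (does-⇔ (mk⇔ (∸-suc-flip i<r) (∸-suc-flip c<r)) (c ℕ.≟ r ∸ suc i) (i ℕ.≟ r ∸ suc c))
... | no c≮r | yes c<r+g
  rewrite <ᵇ-false (ℕₚ.≮⇒≥ c≮r) | <ᵇ-true c<r+g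
        | dec-false (c ℕ.≟ r ∸ suc i) (λ c≡ → c≮r (subst (_< r) (sym c≡) (∸-suc-< i<r)))
        | dec-false (c ℕ.≟ r + (g + i))
            (ℕₚ.<⇒≢ (ℕₚ.<-≤-trans c<r+g (subst (r + g ≤_) (ℕₚ.+-assoc r g i) (ℕₚ.m≤m+n (r + g) i))))
  = sym (if-eta (i ≡ᵇ 0))
... | no c≮r | no c≮r+g
  rewrite <ᵇ-false (ℕₚ.≮⇒≥ c≮r) | <ᵇ-false (ℕₚ.≮⇒≥ c≮r+g)
        | dec-false (c ℕ.≟ r ∸ suc i) (λ c≡ → c≮r (subst (_< r) (sym c≡) (∸-suc-< i<r)))
  = if-cong (does-⇔ (mk⇔ toRight fromRight) (c ℕ.≟ r + (g + i)) (i ℕ.≟ c ∸ (r + g)))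
  where
  toRight : c ≡ r + (g + i) → i ≡ c ∸ (r + g)
  toRight c≡ = sym (trans (cong (_∸ (r + g)) (trans c≡ (sym (ℕₚ.+-assoc r g i)))) (ℕₚ.m+n∸m≡n (r + g) i))
  fromRight : i ≡ c ∸ (r + g) → c ≡ r + (g + i)
  fromRight i≡ = trans (sym (ℕₚ.m+[n∸m]≡n (ℕₚ.≮⇒≥ c≮r+g)))
                       (trans (cong ((r + g) +_) (sym i≡)) (ℕₚ.+-assoc r g i))

gapRow-beyond : ∀ {g r c} → r + g ≤ c → gapRow g r c ≡ c ∸ (r + g)
gapRow-beyond {g} {r} r+g≤c rewrite <ᵇ-false (ℕₚ.≤-trans (ℕₚ.m≤m+n r g) r+g≤c) | <ᵇ-false r+g≤c = refl

gapWeight-beyond : ∀ {g r c} → r + g ≤ c → gapWeight g r c ≡ 1ℤ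
gapWeight-beyond {g} {r} r+g≤c rewrite <ᵇ-false (ℕₚ.≤-trans (ℕₚ.m≤m+n r g) r+g≤c) | <ᵇ-false r+g≤c = refl

gapWeight-gap : ∀ {g r c} → r ≤ c → c < r + g → gapWeight g r c ≡ 0ℤ
gapWeight-gap r≤c c<r+g rewrite <ᵇ-false r≤c | <ᵇ-true c<r+g = refl

gapRow-< : ∀ g {r c} → 0 < r → c < r + r + g → gapRow g r c < r
gapRow-< g {r} {c} r>0 c<2r+g with c <? r | c <? r + g
... | yes c<r | _ rewrite <ᵇ-true c<r = ∸-suc-< c<r
... | no c≮r | yes c<r+g rewrite <ᵇ-false (ℕₚ.≮⇒≥ c≮r) | <ᵇ-true c<r+g = r>0
... | no c≮r | no c≮r+g rewrite <ᵇ-false (ℕₚ.≮⇒≥ c≮r) | <ᵇ-false (ℕₚ.≮⇒≥ c≮r+g) =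
  ℕₚ.m<n+o⇒m∸n<o c (r + g) {{ℕ.>-nonZero r>0}} (subst (c <_) (swap r g) c<2r+g)
  where
  swap : ∀ r g → r + r + g ≡ r + g + r
  swap = solve-∀

-- Partitions

-- InR is FrobeniusShift 0 and InQ is FrobeniusShift 1, definitionally.
FrobeniusShift : ℕ → ∀ {r} → Vec ℕ r → Set
FrobeniusShift g {r} lam = (i : Fin r) → toℕ i < diag lam → frobα lam i ≡ g + frobβ lam i

-- Deleting the first row and the first column of addHook x μ leaves μ.
addHook : ∀ {n} → ℕ → Vec ℕ n → Vec ℕ (suc n)
addHook x μ = suc x ∷ map suc μ

data Shape : ∀ {n} → Vec ℕ (suc n) → Set where
  trailingZero : ∀ {n} (ν : Vec ℕ n) → Shape (ν ∷ʳ 0)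
  hook         : ∀ {n} (x : ℕ) (μ : Vec ℕ n) → Shape (addHook x μ)

lookup-∷ʳ-inject₁ : ∀ {n} (ν : Vec ℕ n) x i → lookup (ν ∷ʳ x) (inject₁ i) ≡ lookup ν i
lookup-∷ʳ-inject₁ (y ∷ ν) x zero = refl
lookup-∷ʳ-inject₁ (y ∷ ν) x (suc i) = lookup-∷ʳ-inject₁ ν x i

lookup-∷ʳ-last : ∀ {n} (ν : Vec ℕ n) x → lookup (ν ∷ʳ x) (fromℕ n) ≡ x
lookup-∷ʳ-last [] x = refl
lookup-∷ʳ-last (y ∷ ν) x = lookup-∷ʳ-last ν x

map-suc-of-positive : ∀ {n} (v : Vec ℕ n) → (∀ i → 0 < lookup v i) → ∃ λ u → v ≡ map suc u
map-suc-of-positive [] _ = [] , refl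
map-suc-of-positive (zero ∷ v) pos = contradiction (pos zero) λ ()
map-suc-of-positive (suc x ∷ v) pos with map-suc-of-positive v (pos ∘ suc)
... | u , refl = x ∷ u , refl

shape : ∀ {n} (lam : Vec ℕ (suc n)) → IsPartition lam → Shape lam
shape {n} lam P with initLast lam
... | ν , zero , refl = trailingZero ν
... | ν , suc y , refl with map-suc-of-positive (ν ∷ʳ suc y) (λ i →
        ℕₚ.≤-trans (s≤s z≤n) (subst (_≤ lookup (ν ∷ʳ suc y) i) (lookup-∷ʳ-last ν (suc y))
          (P i (fromℕ n) (subst (toℕ i ≤_) (sym (Finₚ.toℕ-fromℕ n)) (Finₚ.toℕ≤pred[n] i)))))
...   | x ∷ μ , e = subst Shape (sym e) (hook x μ)

size-map-suc : ∀ {n} (μ : Vec ℕ n) → size (map suc μ) ≡ n + size μ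
size-map-suc [] = refl
size-map-suc {suc n} (y ∷ μ) = trans (cong (suc y +_) (size-map-suc μ)) (cong suc (+-exchange y n (size μ)))

IsPartition-∷ʳ : ∀ {m} (ν : Vec ℕ m) x → IsPartition (ν ∷ʳ x) → IsPartition ν
IsPartition-∷ʳ ν x P i j i≤j = subst₂ _≤_ (lookup-∷ʳ-inject₁ ν x j) (lookup-∷ʳ-inject₁ ν x i)
  (P (inject₁ i) (inject₁ j) (subst₂ _≤_ (sym (Finₚ.toℕ-inject₁ i)) (sym (Finₚ.toℕ-inject₁ j)) i≤j))

count-∷ʳ : ∀ {m} (ν : Vec ℕ m) x (p : ℕ → ℕ → Bool) →
  count (λ i → p (toℕ i) (lookup (ν ∷ʳ x) i)) ≡ count (λ i → p (toℕ i) (lookup ν i)) + boolToℕ (p m x)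
count-∷ʳ {m} ν x p = begin
  count f                                                 ≡⟨ count-punchIn f (fromℕ m) ⟩
  boolToℕ (f (fromℕ m)) + count (f ∘ punchIn (fromℕ m))   ≡⟨ cong₂ _+_ lastTerm (count-cong initTerm) ⟩
  boolToℕ (p m x) + count (λ i → p (toℕ i) (lookup ν i))  ≡⟨ ℕₚ.+-comm (boolToℕ (p m x)) _ ⟩
  count (λ i → p (toℕ i) (lookup ν i)) + boolToℕ (p m x)  ∎
  where
  open ≡-Reasoning
  f : Fin (suc m) → Bool
  f i = p (toℕ i) (lookup (ν ∷ʳ x) i)
  lastTerm : boolToℕ (f (fromℕ m)) ≡ boolToℕ (p m x)
  lastTerm = cong₂ (λ a v → boolToℕ (p a v)) (Finₚ.toℕ-fromℕ m) (lookup-∷ʳ-last ν x)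
  initTerm : ∀ j → f (punchIn (fromℕ m) j) ≡ p (toℕ j) (lookup ν j)
  initTerm j = trans (cong f (punchIn-fromℕ j)) (cong₂ p (Finₚ.toℕ-inject₁ j) (lookup-∷ʳ-inject₁ ν x j))

diag-∷ʳ-zero : ∀ {m} (ν : Vec ℕ m) → diag (ν ∷ʳ 0) ≡ diag ν
diag-∷ʳ-zero ν = trans (count-∷ʳ ν 0 λ a v → ⌊ suc a ≤? v ⌋) (ℕₚ.+-identityʳ (diag ν))

conj-∷ʳ-zero : ∀ {m} (ν : Vec ℕ m) k → conj (ν ∷ʳ 0) (suc k) ≡ conj ν (suc k)
conj-∷ʳ-zero ν k = trans (count-∷ʳ ν 0 λ _ v → ⌊ suc k ≤? v ⌋) (ℕₚ.+-identityʳ (conj ν (suc k)))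

size-∷ʳ : ∀ {m} (ν : Vec ℕ m) x → size (ν ∷ʳ x) ≡ size ν + x
size-∷ʳ ν x = trans (cong sum (Vecₚ.toList-∷ʳ x ν))
                    (trans (sum-++ (toList ν) List.[ x ]) (cong (size ν +_) (ℕₚ.+-identityʳ x)))

frobα-∷ʳ : ∀ {m} (ν : Vec ℕ m) x i → frobα (ν ∷ʳ x) (inject₁ i) ≡ frobα ν i
frobα-∷ʳ ν x i = cong₂ _∸_ (lookup-∷ʳ-inject₁ ν x i) (cong suc (Finₚ.toℕ-inject₁ i))

frobβ-∷ʳ-zero : ∀ {m} (ν : Vec ℕ m) i → frobβ (ν ∷ʳ 0) (inject₁ i) ≡ frobβ ν i
frobβ-∷ʳ-zero ν i rewrite Finₚ.toℕ-inject₁ i = cong (_∸ suc (toℕ i)) (conj-∷ʳ-zero ν (toℕ i))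

Icols-∷ʳ-zero-first : ∀ {m} (ν : Vec ℕ m) → Icols (ν ∷ʳ 0) zero ≡ 0
Icols-∷ʳ-zero-first ν = cong (_+ 0) (lookup-∷ʳ-last ν 0)

Icols-∷ʳ-suc : ∀ {m} (ν : Vec ℕ m) x j → Icols (ν ∷ʳ x) (suc j) ≡ suc (Icols ν j)
Icols-∷ʳ-suc ν x j =
  trans (cong (_+ suc (toℕ j)) (lookup-∷ʳ-inject₁ ν x (opposite j))) (ℕₚ.+-suc (lookup ν (opposite j)) (toℕ j))

FrobeniusShift-∷ʳ-zero : ∀ g {m} (ν : Vec ℕ m) → FrobeniusShift g (ν ∷ʳ 0) ⇔ FrobeniusShift g ν
FrobeniusShift-∷ʳ-zero g {m} ν = mk⇔ forward backward
  where
  forward : FrobeniusShift g (ν ∷ʳ 0) → FrobeniusShift g ν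
  forward shift i i<d = begin
    frobα ν i                       ≡⟨ frobα-∷ʳ ν 0 i ⟨
    frobα (ν ∷ʳ 0) (inject₁ i)      ≡⟨ shift (inject₁ i)
                                         (subst₂ _<_ (sym (Finₚ.toℕ-inject₁ i)) (sym (diag-∷ʳ-zero ν)) i<d) ⟩
    g + frobβ (ν ∷ʳ 0) (inject₁ i)  ≡⟨ cong (g +_) (frobβ-∷ʳ-zero ν i) ⟩
    g + frobβ ν i                   ∎
    where open ≡-Reasoning
  backward : FrobeniusShift g ν → FrobeniusShift g (ν ∷ʳ 0)
  backward shift i i<d with punchInView (fromℕ m) i
  ... | here = contradiction (ℕₚ.≤-trans (subst₂ _<_ (Finₚ.toℕ-fromℕ m) (diag-∷ʳ-zero ν) i<d) (count-≤ _))
                             (ℕₚ.<-irrefl refl)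
  ... | there j rewrite punchIn-fromℕ j = begin
    frobα (ν ∷ʳ 0) (inject₁ j)      ≡⟨ frobα-∷ʳ ν 0 j ⟩
    frobα ν j                       ≡⟨ shift j (subst₂ _<_ (Finₚ.toℕ-inject₁ j) (diag-∷ʳ-zero ν) i<d) ⟩
    g + frobβ ν j                   ≡⟨ cong (g +_) (frobβ-∷ʳ-zero ν j) ⟨
    g + frobβ (ν ∷ʳ 0) (inject₁ j)  ∎
    where open ≡-Reasoning

IsPartition-addHook : ∀ {m} x (μ : Vec ℕ m) → IsPartition (addHook x μ) → IsPartition μ
IsPartition-addHook x μ P i j i≤j = ℕₚ.≤-pred
  (subst₂ _≤_ (Vecₚ.lookup-map j suc μ) (Vecₚ.lookup-map i suc μ) (P (suc i) (suc j) (s≤s i≤j)))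

diag-addHook : ∀ {m} x (μ : Vec ℕ m) → diag (addHook x μ) ≡ suc (diag μ)
diag-addHook x μ = cong suc (count-cong λ i →
  trans (cong (λ v → ⌊ suc (suc (toℕ i)) ≤? v ⌋) (Vecₚ.lookup-map i suc μ)) (≤?-suc (suc (toℕ i)) _))

conj-addHook : ∀ {m} x (μ : Vec ℕ m) k → conj (addHook x μ) (suc k) ≡ boolToℕ ⌊ k ≤? x ⌋ + conj μ k
conj-addHook x μ k = cong₂ _+_ (cong boolToℕ (≤?-suc k x)) (count-cong λ j →
  trans (cong (λ v → ⌊ suc k ≤? v ⌋) (Vecₚ.lookup-map j suc μ)) (≤?-suc k _))

size-addHook : ∀ {m} x (μ : Vec ℕ m) → size (addHook x μ) ≡ suc x + (m + size μ)
size-addHook x μ = cong (suc x +_) (size-map-suc μ)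

frobβ-addHook-zero : ∀ {m} x (μ : Vec ℕ m) → frobβ (addHook x μ) zero ≡ m
frobβ-addHook-zero x μ = count-true _ λ j → cong (λ v → ⌊ 1 ≤? v ⌋) (Vecₚ.lookup-map j suc μ)

frobα-addHook-suc : ∀ {m} x (μ : Vec ℕ m) i → frobα (addHook x μ) (suc i) ≡ frobα μ i
frobα-addHook-suc x μ i = cong (_∸ suc (suc (toℕ i))) (Vecₚ.lookup-map i suc μ)

frobβ-addHook-suc : ∀ {m} x (μ : Vec ℕ m) i → suc (toℕ i) ≤ x → frobβ (addHook x μ) (suc i) ≡ frobβ μ i
frobβ-addHook-suc x μ i i<x =
  cong (_∸ suc (suc (toℕ i))) (trans (conj-addHook x μ (suc (toℕ i))) (cong (λ b → boolToℕ b + _) (≤?-true i<x)))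

Icols-addHook-last : ∀ {m} x (μ : Vec ℕ m) → Icols (addHook x μ) (fromℕ m) ≡ suc x + m
Icols-addHook-last {m} x μ = cong₂ _+_ (cong (lookup (addHook x μ)) (opposite-fromℕ m)) (Finₚ.toℕ-fromℕ m)

Icols-addHook-inject₁ : ∀ {m} x (μ : Vec ℕ m) j → Icols (addHook x μ) (inject₁ j) ≡ suc (Icols μ j)
Icols-addHook-inject₁ x μ j = cong₂ _+_
  (trans (cong (lookup (addHook x μ)) (opposite-inject₁ j)) (Vecₚ.lookup-map (opposite j) suc μ))
  (Finₚ.toℕ-inject₁ j)

FrobeniusShift-addHook : ∀ g {m} x (μ : Vec ℕ m) →
  FrobeniusShift g (addHook x μ) ⇔ (x ≡ g + m × FrobeniusShift g μ)
FrobeniusShift-addHook g {m} x μ = mk⇔ forward backward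
  where
  diag⁺ : ∀ {i} → toℕ i < diag μ → suc (toℕ i) < diag (addHook x μ)
  diag⁺ {i} i<d = subst (suc (toℕ i) <_) (sym (diag-addHook x μ)) (s≤s i<d)
  rowFits : x ≡ g + m → ∀ (i : Fin m) → suc (toℕ i) ≤ x
  rowFits x≡ i = subst (suc (toℕ i) ≤_) (trans (ℕₚ.+-comm m g) (sym x≡))
                       (ℕₚ.≤-trans (Finₚ.toℕ<n i) (ℕₚ.m≤m+n m g))
  forward : FrobeniusShift g (addHook x μ) → x ≡ g + m × FrobeniusShift g μ
  forward shift = x≡ , λ i i<d →
    trans (sym (frobα-addHook-suc x μ i))
          (trans (shift (suc i) (diag⁺ i<d)) (cong (g +_) (frobβ-addHook-suc x μ i (rowFits x≡ i))))
    where
    x≡ : x ≡ g + m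
    x≡ = trans (shift zero (subst (0 <_) (sym (diag-addHook x μ)) (s≤s z≤n))) (cong (g +_) (frobβ-addHook-zero x μ))
  backward : x ≡ g + m × FrobeniusShift g μ → FrobeniusShift g (addHook x μ)
  backward (x≡ , shift) zero _ = trans x≡ (cong (g +_) (sym (frobβ-addHook-zero x μ)))
  backward (x≡ , shift) (suc i) i<d =
    trans (frobα-addHook-suc x μ i)
          (trans (shift i (ℕₚ.≤-pred (subst (suc (toℕ i) <_) (diag-addHook x μ) i<d)))
                 (cong (g +_) (sym (frobβ-addHook-suc x μ i (rowFits x≡ i)))))

-- Classification of the maximal minors

columnRow : ∀ g {r} → Vec ℕ r → Fin r → ℕ
columnRow g {r} lam j = gapRow g r (Icols lam j)

columnWeight : ∀ g {r} → Vec ℕ r → Fin r → ℤ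
columnWeight g {r} lam j = gapWeight g r (Icols lam j)

Fits : ℕ → ∀ {r} → Vec ℕ r → Set
Fits g {r} lam = ∀ j → Icols lam j < r + r + g

-- For g = 0 and g = 1 the exponent is (|λ| + p(λ))/2 and |λ|/2 respectively.
record Nonvanishing (g : ℕ) {r} (lam : Vec ℕ r) : Set where
  field
    shift           : FrobeniusShift g lam
    fits            : Fits g lam
    bijective       : IsRowBijection r (columnRow g lam)
    exponent        : ℕ
    exponent-double : exponent + exponent + diag lam * g ≡ size lam + diag lam
    sign            : signedProduct (columnRow g lam) (columnWeight g lam) ≡ signPow (suc r C 2 + exponent)

record Vanishing (g : ℕ) {r} (lam : Vec ℕ r) : Set where
  field
    noShift    : ¬ FrobeniusShift g lam
    degenerate : Fits g lam → Degenerate (columnRow g lam) (columnWeight g lam)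

double-suc : ∀ m g → suc m + suc m + g ≡ suc (suc (m + m + g))
double-suc m g = cong (λ t → suc (t + g)) (ℕₚ.+-suc m m)

widen : ∀ {m g c} → c < m + m + g → suc c < suc m + suc m + g
widen {m} {g} {c} c<2m+g = subst (suc c <_) (sym (double-suc m g)) (s≤s (ℕₚ.m≤n⇒m≤1+n c<2m+g))

narrow : ∀ {m g c} → suc c < suc m + suc m + g → c ≤ m + m + g
narrow {m} {g} {c} 1+c<2m+2+g = ℕₚ.≤-pred (ℕₚ.≤-pred (subst (suc c <_) (double-suc m g) 1+c<2m+2+g))

C2-suc : ∀ m → suc (suc m) C 2 ≡ suc m + suc m C 2
C2-suc m = trans (sym (Combinatorics.nCk+nC[k+1]≡[n+1]C[k+1] (suc m) 1))
                 (cong (_+ suc m C 2) (Combinatorics.nC1≡n (suc m)))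

module _ (g : ℕ) {m : ℕ} (ν : Vec ℕ m) where

  columnRow-∷ʳ-zero-first : columnRow g (ν ∷ʳ 0) zero ≡ m
  columnRow-∷ʳ-zero-first = cong (gapRow g (suc m)) (Icols-∷ʳ-zero-first ν)

  columnWeight-∷ʳ-zero-first : columnWeight g (ν ∷ʳ 0) zero ≡ -1ℤ
  columnWeight-∷ʳ-zero-first = cong (gapWeight g (suc m)) (Icols-∷ʳ-zero-first ν)

  columnRow-∷ʳ-zero-suc : ∀ j → columnRow g (ν ∷ʳ 0) (suc j) ≡ columnRow g ν j
  columnRow-∷ʳ-zero-suc j = cong (gapRow g (suc m)) (Icols-∷ʳ-suc ν 0 j)

  columnWeight-∷ʳ-zero-suc : ∀ j → columnWeight g (ν ∷ʳ 0) (suc j) ≡ columnWeight g ν j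
  columnWeight-∷ʳ-zero-suc j = cong (gapWeight g (suc m)) (Icols-∷ʳ-suc ν 0 j)

  -- Column 0 enters in front, with weight -1 in the new top row: m inversions and one more sign.
  Nonvanishing-∷ʳ-zero : Nonvanishing g ν → Nonvanishing g (ν ∷ʳ 0)
  Nonvanishing-∷ʳ-zero nonvanishing = record
    { shift = Equivalence.from (FrobeniusShift-∷ʳ-zero g ν) shift
    ; fits = fits′
    ; bijective = IsRowBijection-insertTop _ _ zero columnRow-∷ʳ-zero-first columnRow-∷ʳ-zero-suc bijective
    ; exponent = exponent
    ; exponent-double = subst₂ (λ s d → exponent + exponent + d * g ≡ s + d)
        (sym (trans (size-∷ʳ ν 0) (ℕₚ.+-identityʳ (size ν)))) (sym (diag-∷ʳ-zero ν)) exponent-double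
    ; sign = sign′
    }
    where
    open Nonvanishing nonvanishing
    fits′ : Fits g (ν ∷ʳ 0)
    fits′ zero = subst (_< suc m + suc m + g) (sym (Icols-∷ʳ-zero-first ν)) (s≤s z≤n)
    fits′ (suc j) = subst (_< suc m + suc m + g) (sym (Icols-∷ʳ-suc ν 0 j)) (widen {m} {g} (fits j))
    sign′ : signedProduct (columnRow g (ν ∷ʳ 0)) (columnWeight g (ν ∷ʳ 0))
              ≡ signPow (suc (suc m) C 2 + exponent)
    sign′ = begin
      signedProduct (columnRow g (ν ∷ʳ 0)) (columnWeight g (ν ∷ʳ 0))
        ≡⟨ signedProduct-punchIn (columnRow g (ν ∷ʳ 0)) (columnWeight g (ν ∷ʳ 0)) zero m
             (inversions-insertMax (columnRow g (ν ∷ʳ 0)) (columnRow g ν) zero columnRow-∷ʳ-zero-first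
                                   columnRow-∷ʳ-zero-suc (IsRowBijection.bounded bijective))
             columnWeight-∷ʳ-zero-suc ⟩
      signPow m ℤ.* (columnWeight g (ν ∷ʳ 0) zero ℤ.* signedProduct (columnRow g ν) (columnWeight g ν))
        ≡⟨ cong₂ (λ w s → signPow m ℤ.* (w ℤ.* s)) columnWeight-∷ʳ-zero-first sign ⟩
      signPow m ℤ.* (-1ℤ ℤ.* signPow (suc m C 2 + exponent))
        ≡⟨ cong (signPow m ℤ.*_) (ℤₚ.-1*i≡-i _) ⟩
      signPow m ℤ.* signPow (suc (suc m C 2 + exponent))
        ≡⟨ signPow-+ m _ ⟨
      signPow (m + suc (suc m C 2 + exponent))
        ≡⟨ cong signPow (trans (ℕₚ.+-suc m _) (sym (ℕₚ.+-assoc (suc m) (suc m C 2) exponent))) ⟩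
      signPow (suc m + suc m C 2 + exponent)
        ≡⟨ cong (λ c → signPow (c + exponent)) (C2-suc m) ⟨
      signPow (suc (suc m) C 2 + exponent) ∎
      where open ≡-Reasoning

  Vanishing-∷ʳ-zero : Vanishing g ν → Vanishing g (ν ∷ʳ 0)
  Vanishing-∷ʳ-zero vanishing = record
    { noShift = noShift ∘ Equivalence.to (FrobeniusShift-∷ʳ-zero g ν)
    ; degenerate = degenerate′
    }
    where
    open Vanishing vanishing
    degenerate′ : Fits g (ν ∷ʳ 0) → Degenerate (columnRow g (ν ∷ʳ 0)) (columnWeight g (ν ∷ʳ 0))
    degenerate′ fitsλ with all? (λ j → Icols ν j <? m + m + g)
    ... | yes fitsν = Degenerate-insertTop _ _ zero columnRow-∷ʳ-zero-first columnRow-∷ʳ-zero-suc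
                        columnWeight-∷ʳ-zero-suc (degenerate fitsν)
    -- A column of ν outside its own matrix is the last column of the bigger one: it lies in the top row.
    ... | no ¬fitsν with Finₚ.¬∀⟶∃¬ m _ (λ j → Icols ν j <? m + m + g) ¬fitsν
    ...   | j , ¬fits = repeatedRow {j₁ = zero} {j₂ = suc j} (λ ())
                          (trans columnRow-∷ʳ-zero-first (sym (begin
      columnRow g (ν ∷ʳ 0) (suc j)  ≡⟨ columnRow-∷ʳ-zero-suc j ⟩
      gapRow g m (Icols ν j)        ≡⟨ gapRow-beyond {g} {m} (subst (m + g ≤_) lastColumn (ℕₚ.m≤m+n (m + g) m)) ⟩
      Icols ν j ∸ (m + g)           ≡⟨ cong (_∸ (m + g)) lastColumn ⟨
      (m + g + m) ∸ (m + g)         ≡⟨ ℕₚ.m+n∸m≡n (m + g) m ⟩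
      m                             ∎)))
      where
      open ≡-Reasoning
      swap : ∀ m g → m + g + m ≡ m + m + g
      swap = solve-∀
      lastColumn : m + g + m ≡ Icols ν j
      lastColumn = trans (swap m g) (ℕₚ.≤-antisym (ℕₚ.≮⇒≥ ¬fits)
        (narrow {m} {g} (subst (_< suc m + suc m + g) (Icols-∷ʳ-suc ν 0 j) (fitsλ (suc j)))))

module _ (g : ℕ) {m : ℕ} (x : ℕ) (μ : Vec ℕ m) where

  columnRow-addHook-init : ∀ j → columnRow g (addHook x μ) (punchIn (fromℕ m) j) ≡ columnRow g μ j
  columnRow-addHook-init j = cong (gapRow g (suc m))
    (trans (cong (Icols (addHook x μ)) (punchIn-fromℕ j)) (Icols-addHook-inject₁ x μ j))

  columnWeight-addHook-init : ∀ j → columnWeight g (addHook x μ) (punchIn (fromℕ m) j) ≡ columnWeight g μ j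
  columnWeight-addHook-init j = cong (gapWeight g (suc m))
    (trans (cong (Icols (addHook x μ)) (punchIn-fromℕ j)) (Icols-addHook-inject₁ x μ j))

  Fits-addHook : IsPartition (addHook x μ) → Fits g (addHook x μ) → Fits g μ
  Fits-addHook P fitsλ j = ℕₚ.≤-pred (ℕₚ.≤-trans belowLast (ℕₚ.≤-pred lastFits))
    where
    belowLast : suc (Icols μ j) < suc x + m
    belowLast = subst (_< suc x + m) (Icols-addHook-inject₁ x μ j)
      (ℕₚ.+-mono-≤-< (P zero (opposite (inject₁ j)) z≤n) (subst (_< m) (sym (Finₚ.toℕ-inject₁ j)) (Finₚ.toℕ<n j)))
    lastFits : suc x + m < suc (suc (m + m + g))
    lastFits = subst₂ _<_ (Icols-addHook-last x μ) (double-suc m g) (fitsλ (fromℕ m))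

  module _ (x≡g+m : x ≡ g + m) where

    Icols-addHook-last-matched : Icols (addHook x μ) (fromℕ m) ≡ suc m + g + m
    Icols-addHook-last-matched = trans (Icols-addHook-last x μ) (cong (λ t → suc t + m) (trans x≡g+m (ℕₚ.+-comm g m)))

    columnRow-addHook-last : columnRow g (addHook x μ) (fromℕ m) ≡ m
    columnRow-addHook-last = begin
      gapRow g (suc m) (Icols (addHook x μ) (fromℕ m)) ≡⟨ cong (gapRow g (suc m)) Icols-addHook-last-matched ⟩
      gapRow g (suc m) (suc m + g + m)                 ≡⟨ gapRow-beyond {g} {suc m} (ℕₚ.m≤m+n (suc m + g) m) ⟩
      (suc m + g + m) ∸ (suc m + g)                     ≡⟨ ℕₚ.m+n∸m≡n (suc m + g) m ⟩
      m                                                 ∎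
      where open ≡-Reasoning

    columnWeight-addHook-last : columnWeight g (addHook x μ) (fromℕ m) ≡ 1ℤ
    columnWeight-addHook-last = trans (cong (gapWeight g (suc m)) Icols-addHook-last-matched)
                                      (gapWeight-beyond {g} {suc m} (ℕₚ.m≤m+n (suc m + g) m))

    exponent-double-addHook : ∀ e → e + e + diag μ * g ≡ size μ + diag μ →
      (e + suc m) + (e + suc m) + diag (addHook x μ) * g ≡ size (addHook x μ) + diag (addHook x μ)
    exponent-double-addHook e double = begin
      (e + suc m) + (e + suc m) + diag (addHook x μ) * g
        ≡⟨ cong (λ d → (e + suc m) + (e + suc m) + d * g) (diag-addHook x μ) ⟩
      (e + suc m) + (e + suc m) + suc (diag μ) * g
        ≡⟨ regroup e m g (diag μ) ⟩
      (e + e + diag μ * g) + (suc m + suc m + g)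
        ≡⟨ cong (_+ (suc m + suc m + g)) double ⟩
      (size μ + diag μ) + (suc m + suc m + g)
        ≡⟨ regroup′ (size μ) (diag μ) m g ⟩
      suc (g + m) + (m + size μ) + suc (diag μ)
        ≡⟨ cong₂ _+_ (trans (cong (λ t → suc t + (m + size μ)) (sym x≡g+m)) (sym (size-addHook x μ)))
                     (sym (diag-addHook x μ)) ⟩
      size (addHook x μ) + diag (addHook x μ) ∎
      where
      open ≡-Reasoning
      regroup : ∀ e m g d → (e + suc m) + (e + suc m) + suc d * g ≡ (e + e + d * g) + (suc m + suc m + g)
      regroup = solve-∀
      regroup′ : ∀ s d m g → (s + d) + (suc m + suc m + g) ≡ suc (g + m) + (m + s) + suc d
      regroup′ = solve-∀

    -- The last column enters behind, with weight +1 in the new top row: no new inversions.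
    Nonvanishing-addHook : Nonvanishing g μ → Nonvanishing g (addHook x μ)
    Nonvanishing-addHook nonvanishing = record
      { shift = Equivalence.from (FrobeniusShift-addHook g x μ) (x≡g+m , shift)
      ; fits = fits′
      ; bijective = IsRowBijection-insertTop _ _ (fromℕ m) columnRow-addHook-last columnRow-addHook-init bijective
      ; exponent = exponent + suc m
      ; exponent-double = exponent-double-addHook exponent exponent-double
      ; sign = sign′
      }
      where
      open Nonvanishing nonvanishing
      fits′ : Fits g (addHook x μ)
      fits′ j with punchInView (fromℕ m) j
      ... | here = subst (_< suc m + suc m + g) (sym Icols-addHook-last-matched) (lastFits m g)
        where
        lastFits : ∀ m g → suc m + g + m < suc m + suc m + g
        lastFits m g = subst (suc m + g + m <_) (swap m g) (ℕₚ.n<1+n _)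
          where
          swap : ∀ m g → suc (suc m + g + m) ≡ suc m + suc m + g
          swap = solve-∀
      ... | there j′ = subst (_< suc m + suc m + g)
                         (sym (trans (cong (Icols (addHook x μ)) (punchIn-fromℕ j′)) (Icols-addHook-inject₁ x μ j′)))
                         (widen {m} {g} (fits j′))
      sign′ : signedProduct (columnRow g (addHook x μ)) (columnWeight g (addHook x μ))
                ≡ signPow (suc (suc m) C 2 + (exponent + suc m))
      sign′ = begin
        signedProduct (columnRow g (addHook x μ)) (columnWeight g (addHook x μ))
          ≡⟨ signedProduct-punchIn (columnRow g (addHook x μ)) (columnWeight g (addHook x μ))
               (fromℕ m) (m ∸ toℕ (fromℕ m))
               (inversions-insertMax (columnRow g (addHook x μ)) (columnRow g μ) (fromℕ m)
                                     columnRow-addHook-last columnRow-addHook-init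
                                     (IsRowBijection.bounded bijective))
               columnWeight-addHook-init ⟩
        signPow (m ∸ toℕ (fromℕ m))
          ℤ.* (columnWeight g (addHook x μ) (fromℕ m) ℤ.* signedProduct (columnRow g μ) (columnWeight g μ))
          ≡⟨ cong₂ (λ a t → signPow a ℤ.* t) (trans (cong (m ∸_) (Finₚ.toℕ-fromℕ m)) (ℕₚ.n∸n≡0 m))
                   (cong₂ ℤ._*_ columnWeight-addHook-last sign) ⟩
        1ℤ ℤ.* (1ℤ ℤ.* signPow (suc m C 2 + exponent))
          ≡⟨ trans (ℤₚ.*-identityˡ _) (ℤₚ.*-identityˡ _) ⟩
        signPow (suc m C 2 + exponent)
          ≡⟨ signPow-double (suc m) _ ⟨
        signPow (suc m + suc m + (suc m C 2 + exponent))
          ≡⟨ cong signPow (regroup (suc m) (suc m C 2) exponent) ⟩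
        signPow ((suc m + suc m C 2) + (exponent + suc m))
          ≡⟨ cong (λ c → signPow (c + (exponent + suc m))) (C2-suc m) ⟨
        signPow (suc (suc m) C 2 + (exponent + suc m)) ∎
        where
        open ≡-Reasoning
        regroup : ∀ a c e → a + a + (c + e) ≡ (a + c) + (e + a)
        regroup = solve-∀

    Vanishing-addHook : IsPartition (addHook x μ) → Vanishing g μ → Vanishing g (addHook x μ)
    Vanishing-addHook P vanishing = record
      { noShift = noShift ∘ proj₂ ∘ Equivalence.to (FrobeniusShift-addHook g x μ)
      ; degenerate = λ fitsλ → Degenerate-insertTop _ _ (fromℕ m) columnRow-addHook-last columnRow-addHook-init
                                 columnWeight-addHook-init (degenerate (Fits-addHook P fitsλ))
      }
      where open Vanishing vanishing

  -- Otherwise the last column lies in the gap or in a row below the top row, which stays empty.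
  Vanishing-addHook-mismatched : x ≢ g + m → IsPartition (addHook x μ) → Vanishing g (addHook x μ)
  Vanishing-addHook-mismatched x≢g+m P = record
    { noShift = x≢g+m ∘ proj₁ ∘ Equivalence.to (FrobeniusShift-addHook g x μ)
    ; degenerate = degenerate′
    }
    where
    lastColumn = Icols (addHook x μ) (fromℕ m)
    degenerate′ : Fits g (addHook x μ) → Degenerate (columnRow g (addHook x μ)) (columnWeight g (addHook x μ))
    degenerate′ fitsλ with lastColumn <? suc m + g
    ... | yes inGap = zeroWeight {j = fromℕ m} (gapWeight-gap afterLeft inGap)
      where
      afterLeft : suc m ≤ lastColumn
      afterLeft = subst (suc m ≤_) (sym (Icols-addHook-last x μ)) (ℕₚ.+-monoˡ-≤ m (s≤s z≤n))
    ... | no ¬inGap = missingRow (fromℕ m) missing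
      where
      missing : ∀ j → columnRow g (addHook x μ) j ≢ toℕ (fromℕ m)
      missing j with punchInView (fromℕ m) j
      ... | here = λ row≡ → x≢g+m (ℕₚ.suc-injective (ℕₚ.+-cancelʳ-≡ m _ _ (begin
        suc x + m                                          ≡⟨ Icols-addHook-last x μ ⟨
        lastColumn                                         ≡⟨ ℕₚ.m+[n∸m]≡n (ℕₚ.≮⇒≥ ¬inGap) ⟨
        (suc m + g) + (lastColumn ∸ (suc m + g))           ≡⟨ cong ((suc m + g) +_)
                                                                   (gapRow-beyond {g} {suc m} (ℕₚ.≮⇒≥ ¬inGap)) ⟨
        (suc m + g) + columnRow g (addHook x μ) (fromℕ m)  ≡⟨ cong ((suc m + g) +_) (trans row≡ (Finₚ.toℕ-fromℕ m)) ⟩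
        (suc m + g) + m                                    ≡⟨ cong (λ t → suc t + m) (ℕₚ.+-comm m g) ⟩
        suc (g + m) + m                                    ∎)))
        where open ≡-Reasoning
      ... | there j′ = λ row≡ →
        ℕₚ.<-irrefl (trans (sym (columnRow-addHook-init j′)) (trans row≡ (Finₚ.toℕ-fromℕ m)))
                    (gapRow-< g (ℕₚ.≤-<-trans z≤n (Finₚ.toℕ<n j′)) (Fits-addHook P fitsλ j′))

classify : ∀ g {r} (lam : Vec ℕ r) → IsPartition lam → Nonvanishing g lam ⊎ Vanishing g lam
classify g [] P = inj₁ (record
  { shift = λ ()
  ; fits = λ ()
  ; bijective = record { bounded = λ () ; surjective = λ _ () ; injective = λ { {()} } }
  ; exponent = 0
  ; exponent-double = refl
  ; sign = refl
  })
classify g {suc m} lam P with shape lam P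
... | trailingZero ν =
  Sum.map (Nonvanishing-∷ʳ-zero g ν) (Vanishing-∷ʳ-zero g ν) (classify g ν (IsPartition-∷ʳ ν 0 P))
... | hook x μ with x ℕ.≟ g + m
...   | yes x≡g+m = Sum.map (Nonvanishing-addHook g x μ x≡g+m) (Vanishing-addHook g x μ x≡g+m P)
                            (classify g μ (IsPartition-addHook x μ P))
...   | no x≢g+m = inj₂ (Vanishing-addHook-mismatched g x μ x≢g+m P)

detΔ-fits : ∀ {r W} (M : Fin r → Fin W → ℤ) (cols : Fin r → ℕ) (fits : ∀ j → cols j < W) →
  detΔ M cols ≡ det r (λ i j → M i (fromℕ< (fits j)))
detΔ-fits {W = W} M cols fits with all? (λ j → cols j <? W)
... | yes _ = refl
... | no ¬fits = contradiction fits ¬fits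

detΔ-vanishes : ∀ {r W} (M : Fin r → Fin W → ℤ) (cols : Fin r → ℕ) →
  ((fits : ∀ j → cols j < W) → det r (λ i j → M i (fromℕ< (fits j))) ≡ 0ℤ) → detΔ M cols ≡ 0ℤ
detΔ-vanishes {W = W} M cols vanishes with all? (λ j → cols j <? W)
... | yes fits = vanishes fits
... | no _ = refl

columns-asMonomial : ∀ g {r W} (M : Fin r → Fin W → ℤ) → (∀ i c → M i c ≡ gapEntry g r (toℕ i) (toℕ c)) →
  (lam : Vec ℕ r) (fits : ∀ j → Icols lam j < W) → ∀ i j →
  M i (fromℕ< (fits j)) ≡ monomial (columnRow g lam) (columnWeight g lam) i j
columns-asMonomial g {r} M entries lam fits i j = trans (entries i _)
  (trans (cong (gapEntry g r (toℕ i)) (Finₚ.toℕ-fromℕ< (fits j)))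
         (gapEntry-monomial g r (toℕ i) (Icols lam j) (Finₚ.toℕ<n i)))

detΔ-gapMatrix : ∀ g r {W} (M : Fin r → Fin W → ℤ) → W ≡ r + r + g →
  (∀ i c → M i c ≡ gapEntry g r (toℕ i) (toℕ c)) → (lam : Vec ℕ r) → IsPartition lam →
  (FrobeniusShift g lam → ∃ λ e → e + e + diag lam * g ≡ size lam + diag lam
                                 × detΔ M (Icols lam) ≡ signPow (suc r C 2 + e))
  × (¬ FrobeniusShift g lam → detΔ M (Icols lam) ≡ 0ℤ)
detΔ-gapMatrix g r M refl entries lam P with classify g lam P
... | inj₁ nonvanishing = (λ _ → exponent , exponent-double , detΔ≡) , contradiction shift
  where
  open Nonvanishing nonvanishing
  detΔ≡ : detΔ M (Icols lam) ≡ signPow (suc r C 2 + exponent)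
  detΔ≡ = begin
    detΔ M (Icols lam)                                        ≡⟨ detΔ-fits M (Icols lam) fits ⟩
    det r (λ i j → M i (fromℕ< (fits j)))                     ≡⟨ det-cong r (columns-asMonomial g M entries lam fits) ⟩
    det r (monomial (columnRow g lam) (columnWeight g lam))   ≡⟨ det-monomial-bijective r _ _ bijective ⟩
    signedProduct (columnRow g lam) (columnWeight g lam)      ≡⟨ sign ⟩
    signPow (suc r C 2 + exponent)                            ∎
    where open ≡-Reasoning
... | inj₂ vanishing = (λ shift → contradiction shift noShift) , λ _ →
  detΔ-vanishes M (Icols lam) λ fits →
    trans (det-cong r (columns-asMonomial g M entries lam fits)) (det-monomial-degenerate r (degenerate fits))
  where open Vanishing vanishing

half-of-double : ∀ {e n} → e + e ≡ n → n / 2 ≡ e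
half-of-double {e} e+e≡n = trans (cong (_/ 2) (trans (sym e+e≡n) (double≡*2 e))) (m*n/n≡m e 2)
  where
  double≡*2 : ∀ e → e + e ≡ e * 2
  double≡*2 = solve-∀

exponent-gap0 : ∀ {e s d} → e + e + d * 0 ≡ s + d → (s + d) / 2 ≡ e
exponent-gap0 {e} {s} {d} double =
  half-of-double (trans (sym (trans (cong (e + e +_) (ℕₚ.*-zeroʳ d)) (ℕₚ.+-identityʳ (e + e)))) double)

exponent-gap1 : ∀ {e s d} → e + e + d * 1 ≡ s + d → s / 2 ≡ e
exponent-gap1 {e} {s} {d} double =
  half-of-double (ℕₚ.+-cancelʳ-≡ d _ _ (trans (cong (e + e +_) (sym (ℕₚ.*-identityʳ d))) double))

mainTheorem4 : (r : ℕ) → 1 ≤ r → (lam : Vec ℕ r) → IsPartition lam →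
    ((InR lam → detΔ (Bmat r) (Icols lam) ≡ signPow ((suc r C 2) + (size lam + diag lam) / 2))
    × (¬ InR lam → detΔ (Bmat r) (Icols lam) ≡ 0ℤ))
    × ((InQ lam → detΔ (Cmat r) (Icols lam) ≡ signPow ((suc r C 2) + size lam / 2))
    × (¬ InQ lam → detΔ (Cmat r) (Icols lam) ≡ 0ℤ))
mainTheorem4 r _ lam P = (caseB , proj₂ minorsB) , (caseC , proj₂ minorsC)
  where
  minorsB = detΔ-gapMatrix 0 r (Bmat r) (sym (ℕₚ.+-identityʳ (r + r))) (λ _ _ → refl) lam P
  minorsC = detΔ-gapMatrix 1 r (Cmat r) (ℕₚ.+-comm 1 (r + r)) (λ _ _ → refl) lam P
  caseB : InR lam → detΔ (Bmat r) (Icols lam) ≡ signPow (suc r C 2 + (size lam + diag lam) / 2)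
  caseB inR with proj₁ minorsB inR
  ... | e , double , detΔ≡ = trans detΔ≡ (cong (λ t → signPow (suc r C 2 + t)) (sym (exponent-gap0 {e} {size lam} {diag lam} double)))
  caseC : InQ lam → detΔ (Cmat r) (Icols lam) ≡ signPow (suc r C 2 + size lam / 2)
  caseC inQ with proj₁ minorsC inQ
  ... | e , double , detΔ≡ = trans detΔ≡ (cong (λ t → signPow (suc r C 2 + t)) (sym (exponent-gap1 {e} {size lam} {diag lam} double)))
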